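{- Let $(N_1,m_1)\vartriangleright_E(N_2,m_2)$ and let $G$ be a well-formed TFG for this equivalence. For every marking $m_1'$ of $N_1$, $m_1'\in R(N_1,m_1)$ if and only if there exists a total, well-defined configuration $c$ of $G$ with $c\equiv m_1'$ and $c_{|N_2}\in R(N_2,m_2)$. (Thus deciding whether $m_1'$ is reachable in $(N_1,m_1)$ amounts to constructing the total, well-defined configuration $c\equiv m_1'$, if any, and checking whether $c_{|N_2}$ is reachable in $(N_2,m_2)$.)
   Context: A Petri net $N=(P,T,\mathrm{Pre},\mathrm{Post})$ has a finite set of places $P$, a finite set of transitions $T$, and flow functions $\mathrm{Pre},\mathrm{Post}:T\to(P\to\mathbb{N})$. A marking is $m:P\to\mathbb{N}$; $t$ is enabled at $m$ if $m\ge\mathrm{Pre}(t)$, and firing gives $m-\mathrm{Pre}(t)+\mathrm{Post}(t)$. $R(N,m_0)$ is the set of markings reachable from $m_0$ by finite (possibly empty) firing sequences. Linear systems: $E$ is a finite collection of equations $x=y_1+\dots+y_l$, with variable set $\mathrm{fv}(E)$; solutions are non-negative integer; consistent means having a solution. For a partial map $c$ defined exactly on $v_1,\dots,v_k$, $[c]$ is the system $v_1=c(v_1),\dots,v_k=c(v_k)$; commas denote union. $E$-equivalence: $(N_1,m_1)\vartriangleright_E(N_2,m_2)$ (place sets $P_1,P_2$) iff (A1) $E,[m]$ consistent for every $m\in R(N_1,m_1)\cup R(N_2,m_2)$; (A2) $E,[m_1],[m_2]$ consistent; (A3) for all markings $m_1'$ of $N_1$, $m_2'$ of $N_2$ with $E,[m_1'],[m_2']$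 consistent, $m_1'\in R(N_1,m_1)\iff m_2'\in R(N_2,m_2)$. TFGs: fix pairwise disjoint sets $K(n)$, $n\in\mathbb{N}$, of constant nodes of value $n$, disjoint from place/variable names; $K=\bigcup_nK(n)$. A TFG with places $P$ is $(V,R,A)$, $V=P\cup S$ with $S\subset K$ finite, $R,A\subseteq V\times V$ disjoint; $v\mathbin{\to\!\bullet} w$ iff $(v,w)\in R$, $v\mathbin{\circ\!\to} w$ iff $(v,w)\in A$, $v\to w$ for either. Roots have no incoming arc; $\circ$-leaves have no outgoing $A$-arc. $v\mathbin{\circ\!\to} X$: $X$ is the nonempty set of all $A$-successors of $v$; $X\mathbin{\to\!\bullet} v$: $X$ is the nonempty set of all $R$-predecessors of $v$. Well-formed TFG for $(N_1,m_1)\vartriangleright_E(N_2,m_2)$: (T1) $V\setminus K=P_1\cup P_2\cup\mathrm{fv}(E)$; (T2) nodes in $V\cap K$ are roots; (T3) not both $p\mathbin{\circ\!\to} q$ and $p'\to q$ with $p\ne p'$, and not both $p\mathbin{\to\!\bullet} q$ and $p\mathbin{\circ\!\to} q$; (T4) $v\mathbin{\circ\!\to} X$ or $X\mathbin{\to\!\bullet} v$ iff the equation $v=\sum_{x\in X}x$ is in $E$; (T5) acyclic; (T6) roots not in $K$ are exactly $P_2$, $\circ$-leaves not in $K$ exactly $P_1$. A configuration is a partial $c:V\to\mathbb{N}$ ($\bot$ where undefined) with $c(v)=n$ for $v\in V\cap K(n)$; total if defined everywhere; $c_{|N}$ is its restriction to the places of $N$. For a marking $m$, $c\equiv m$ means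 $c(p)=m(p)$ for all places $p$ where both are defined. $c$ is well-defined if (CBot) whenever $v\to w$, $c(v)=\bot\iff c(w)=\bot$; (CEq) whenever $c(v)\ne\bot$ and ($v\mathbin{\circ\!\to} X$ or $X\mathbin{\to\!\bullet} v$), $c(v)=\sum_{x\in X}c(x)$. -}

module Defs where

open import Data.Nat using (ℕ; _≤_; _+_; _∸_)
open import Data.Fin using (Fin)
open import Data.List using (List; []; _∷_)
open import Data.List.Membership.Propositional using (_∈_; _∉_)
open import Data.List.Relation.Unary.Unique.Propositional using (Unique)
open import Data.List.Relation.Unary.Any using (Any)
open import Data.Maybe using (Maybe; just; nothing)
open import Data.Product using (Σ; ∃; _×_; _,_)
open import Data.Sum using (_⊎_)
open import Data.Empty using (⊥)
open import Relation.Nullary using (¬_)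
open import Relation.Binary.PropositionalEquality using (_≡_; _≢_)
open import Relation.Binary.Construct.Closure.Transitive using (TransClosure)
open import Function.Bundles using (_⇔_)

-- A node is either a
-- name, or a constant node  const n i  (the i-th constant node of
-- value n); so K(n) = { const n i | i : ℕ }, pairwise disjoint and
-- disjoint from the names.

Name : Set
Name = ℕ

data Node : Set where
  name  : Name → Node
  const : (n i : ℕ) → Node

-- Pre/Post and markings are functions Name → ℕ of which only the values
-- on the places are meaningful (everything below only inspects places).

record Net : Set where
  field
    places : List Name
    nT     : ℕ
    pre    : Fin nT → Name → ℕ
    post   : Fin nT → Name → ℕ
open Net public

Marking : Set
Marking = Name → ℕ

AgreeOn : List Name → (Name → ℕ) → (Name → ℕ) → Set
AgreeOn P m m' = ∀ p → p ∈ P → m p ≡ m' p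

Enabled : (N : Net) → Marking → Fin (nT N) → Set
Enabled N m t = ∀ p → p ∈ places N → pre N t p ≤ m p

fire : (N : Net) → Marking → Fin (nT N) → Marking
fire N m t p = m p ∸ pre N t p + post N t p

data Steps (N : Net) : Marking → Marking → Set where
  done : ∀ {m} → Steps N m m
  step : ∀ {m m'} (t : Fin (nT N)) → Enabled N m t →
         Steps N (fire N m t) m' → Steps N m m'

Reach : Net → Marking → Marking → Set
Reach N m0 m = ∃ λ m'' → Steps N m0 m'' × AgreeOn (places N) m'' m

Equation : Set
Equation = Node × List Node

System : Set
System = List Equation

Assignment : Set
Assignment = Name → ℕ

eval : Assignment → Node → ℕ
eval σ (name x)    = σ x
eval σ (const n i) = n

sumEval : Assignment → List Node → ℕ
sumEval σ []       = 0
sumEval σ (y ∷ ys) = eval σ y + sumEval σ ys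

Solves : Assignment → System → Set
Solves σ E = ∀ x ys → (x , ys) ∈ E → eval σ x ≡ sumEval σ ys

data OccursIn (x : Name) : Equation → Set where
  lhs : ∀ {ys} → OccursIn x (name x , ys)
  rhs : ∀ {v ys} → name x ∈ ys → OccursIn x (v , ys)

fv : System → Name → Set
fv E x = Any (OccursIn x) E

ConsistentWith1 : System → List Name → Marking → Set
ConsistentWith1 E P m = ∃ λ σ → Solves σ E × AgreeOn P σ m

ConsistentWith2 : System → List Name → Marking → List Name → Marking → Set
ConsistentWith2 E P m P' m' =
  ∃ λ σ → Solves σ E × AgreeOn P σ m × AgreeOn P' σ m'

record EEquiv (E : System) (N₁ : Net) (m₁ : Marking)
              (N₂ : Net) (m₂ : Marking) : Set where
  field
    A1₁ : ∀ m → Reach N₁ m₁ m → ConsistentWith1 E (places N₁) m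
    A1₂ : ∀ m → Reach N₂ m₂ m → ConsistentWith1 E (places N₂) m
    A2  : ConsistentWith2 E (places N₁) m₁ (places N₂) m₂
    A3  : ∀ m₁' m₂' → ConsistentWith2 E (places N₁) m₁' (places N₂) m₂' →
          Reach N₁ m₁ m₁' ⇔ Reach N₂ m₂ m₂'

record TFG : Set where
  field
    V : List Node
    R : List (Node × Node)      -- v →• w
    A : List (Node × Node)      -- v ∘→ w
open TFG public

_⟶_∈_ : Node → Node → TFG → Set
v ⟶ w ∈ G = ((v , w) ∈ R G) ⊎ ((v , w) ∈ A G)

IsRoot : TFG → Node → Set
IsRoot G v = ∀ u → ¬ (u ⟶ v ∈ G)

IsCircLeaf : TFG → Node → Set
IsCircLeaf G v = ∀ w → (v , w) ∉ A G

CircTo : TFG → Node → List Node → Set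
CircTo G v ys = Unique ys × ys ≢ [] × (∀ w → (w ∈ ys) ⇔ ((v , w) ∈ A G))

ToBullet : TFG → List Node → Node → Set
ToBullet G ys v = Unique ys × ys ≢ [] × (∀ w → (w ∈ ys) ⇔ ((w , v) ∈ R G))

record TFGStruct (G : TFG) : Set where
  field
    R⊆V×V : ∀ v w → (v , w) ∈ R G → v ∈ V G × w ∈ V G
    A⊆V×V : ∀ v w → (v , w) ∈ A G → v ∈ V G × w ∈ V G
    R∩A=∅ : ∀ v w → (v , w) ∈ R G → (v , w) ∉ A G

record WellFormed (E : System) (N₁ N₂ : Net) (G : TFG) : Set where
  field
    struct : TFGStruct G
    T1 : ∀ x → (name x ∈ V G) ⇔ (x ∈ places N₁ ⊎ x ∈ places N₂ ⊎ fv E x)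
    T2 : ∀ n i → const n i ∈ V G → IsRoot G (const n i)
    T3a : ∀ p p' q → (p , q) ∈ A G → p' ⟶ q ∈ G → p ≡ p'
    T3b : ∀ p q → ¬ (((p , q) ∈ R G) × ((p , q) ∈ A G))
    T4→∘ : ∀ v ys → CircTo G v ys → Σ (List Node) λ zs →
             (v , zs) ∈ E × (∀ w → (w ∈ zs) ⇔ (w ∈ ys)) × Unique zs
    T4→• : ∀ v ys → ToBullet G ys v → Σ (List Node) λ zs →
             (v , zs) ∈ E × (∀ w → (w ∈ zs) ⇔ (w ∈ ys)) × Unique zs
    T4← : ∀ v ys → (v , ys) ∈ E → CircTo G v ys ⊎ ToBullet G ys v
    T5 : ∀ v → ¬ TransClosure (λ a b → a ⟶ b ∈ G) v v
    T6roots  : ∀ x → (name x ∈ V G × IsRoot G (name x)) ⇔ (x ∈ places N₂)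
    T6leaves : ∀ x → (name x ∈ V G × IsCircLeaf G (name x)) ⇔ (x ∈ places N₁)

-- Configurations: partial maps Node → ℕ (only values on V matter)

Config : Set
Config = Node → Maybe ℕ

IsConfig : TFG → Config → Set
IsConfig G c = ∀ n i → const n i ∈ V G → c (const n i) ≡ just n

Total : TFG → Config → Set
Total G c = ∀ v → v ∈ V G → ∃ λ a → c v ≡ just a

msum : Config → List Node → Maybe ℕ
msum c []       = just 0
msum c (y ∷ ys) with c y | msum c ys
... | just a | just b = just (a + b)
... | _      | _      = nothing

WellDefined : TFG → Config → Set
WellDefined G c =
  (∀ v w → v ⟶ w ∈ G → (c v ≡ nothing) ⇔ (c w ≡ nothing)) ×
  (∀ v a ys → c v ≡ just a → CircTo G v ys ⊎ ToBullet G ys v →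
     msum c ys ≡ just a)

ConfAgrees : Config → List Name → Marking → Set
ConfAgrees c P m = ∀ p → p ∈ P → ∀ a → c (name p) ≡ just a → a ≡ m p

Restricts : Config → Net → Marking → Set
Restricts c N m = ∀ p → p ∈ places N → c (name p) ≡ just (m p)

{-# OPTIONS --safe #-}
module Submission where

-- The arcs of a well-formed TFG are exactly the equations of E, so a
-- total configuration is well-defined iff the values it gives are a
-- solution of E.  A reachable m₁' extends by (A1) to a solution σ of E,
-- which is a total well-defined configuration whose N₂-part is reachable
-- by (A3).  Conversely a total well-defined configuration c ≡ m₁' is a
-- solution of E, [m₁'], [c|N₂], so (A3) transfers reachability of c|N₂
-- back to m₁'.

open import Defs
open import Data.Product using (∃; _×_)
open import Function.Bundles using (_⇔_)

open import Data.Empty using (⊥-elim)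
open import Data.List using (List; []; _∷_; map)
open import Data.List.Membership.Propositional using (_∈_)
open import Data.List.Membership.Propositional.Properties.WithK using (unique∧set⇒bag)
open import Data.List.Relation.Binary.BagAndSetEquality using (∼bag⇒↭)
open import Data.List.Relation.Binary.Permutation.Propositional using (_↭_)
open import Data.List.Relation.Binary.Permutation.Propositional.Properties using (map⁺)
open import Data.List.Relation.Unary.Any using (here; there)
open import Data.List.Relation.Unary.Unique.Propositional using (Unique)
open import Data.Maybe using (just; fromMaybe)
open import Data.Maybe.Properties using (just-injective)
open import Data.Nat using (_+_)
open import Data.Nat.ListAction using (sum)
open import Data.Nat.ListAction.Properties using (sum-↭)
open import Data.Product using (_,_; proj₁; proj₂)
open import Data.Sum using (_⊎_; inj₁; inj₂)
open import Function.Bundles using (Equivalence; mk⇔)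
open import Relation.Binary.PropositionalEquality
  using (_≡_; refl; sym; cong; module ≡-Reasoning)

open Equivalence using (to; from)

unique∧same-elements⇒↭ : ∀ {ys zs : List Node} → Unique ys → Unique zs →
                         (∀ w → (w ∈ ys) ⇔ (w ∈ zs)) → ys ↭ zs
unique∧same-elements⇒↭ uys uzs same = ∼bag⇒↭ (unique∧set⇒bag uys uzs (same _))

sumEval≡sum∘map : ∀ σ ys → sumEval σ ys ≡ sum (map (eval σ) ys)
sumEval≡sum∘map σ []       = refl
sumEval≡sum∘map σ (y ∷ ys) = cong (eval σ y +_) (sumEval≡sum∘map σ ys)

sumEval-↭ : ∀ σ {ys zs} → ys ↭ zs → sumEval σ ys ≡ sumEval σ zs
sumEval-↭ σ {ys} {zs} ys↭zs = begin
  sumEval σ ys            ≡⟨ sumEval≡sum∘map σ ys ⟩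
  sum (map (eval σ) ys)   ≡⟨ sum-↭ (map⁺ (eval σ) ys↭zs) ⟩
  sum (map (eval σ) zs)   ≡⟨ sym (sumEval≡sum∘map σ zs) ⟩
  sumEval σ zs            ∎
  where open ≡-Reasoning

msum-eval : ∀ (c : Config) σ ys → (∀ y → y ∈ ys → c y ≡ just (eval σ y)) →
            msum c ys ≡ just (sumEval σ ys)
msum-eval c σ []       _   = refl
msum-eval c σ (y ∷ ys) c≡σ
  rewrite c≡σ y (here refl) | msum-eval c σ ys (λ w w∈ys → c≡σ w (there w∈ys)) = refl

ArcSet : TFG → Node → List Node → Set
ArcSet G v ys = CircTo G v ys ⊎ ToBullet G ys v

configOf : Assignment → Config
configOf σ v = just (eval σ v)

-- The default 0 is junk; it is only read off total configurations.
assignmentOf : Config → Assignment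
assignmentOf c x = fromMaybe 0 (c (name x))

total⇒configOf-assignmentOf : ∀ {G c} → IsConfig G c → Total G c →
                               ∀ v → v ∈ V G → c v ≡ configOf (assignmentOf c) v
total⇒configOf-assignmentOf isC tot (name x) x∈V with tot (name x) x∈V
... | _ , cx≡a rewrite cx≡a = refl
total⇒configOf-assignmentOf isC tot (const n i) k∈V = isC n i k∈V

restricts⇒agreeOn : ∀ {c N m} → Restricts c N m → AgreeOn (places N) (assignmentOf c) m
restricts⇒agreeOn res p p∈P rewrite res p p∈P = refl

module _ {E N₁ N₂ G} (wf : WellFormed E N₁ N₂ G) where
  open WellFormed wf
  open TFGStruct struct

  arcSet⇒equation : ∀ {v ys} → ArcSet G v ys → ∃ λ zs → (v , zs) ∈ E × zs ↭ ys
  arcSet⇒equation {v} {ys} (inj₁ circ@(uys , _)) with T4→∘ v ys circ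
  ... | zs , v=zs , same , uzs = zs , v=zs , unique∧same-elements⇒↭ uzs uys same
  arcSet⇒equation {v} {ys} (inj₂ bullet@(uys , _)) with T4→• v ys bullet
  ... | zs , v=zs , same , uzs = zs , v=zs , unique∧same-elements⇒↭ uzs uys same

  arcSet⊆V : ∀ {v ys} → ArcSet G v ys → v ∈ V G × (∀ y → y ∈ ys → y ∈ V G)
  arcSet⊆V {ys = []}    (inj₁ (_ , ys≢[] , _)) = ⊥-elim (ys≢[] refl)
  arcSet⊆V {ys = []}    (inj₂ (_ , ys≢[] , _)) = ⊥-elim (ys≢[] refl)
  arcSet⊆V {v} {y ∷ _} (inj₁ (_ , _ , succ)) =
    proj₁ (A⊆V×V v y (to (succ y) (here refl))) ,
    λ w w∈ys → proj₂ (A⊆V×V v w (to (succ w) w∈ys))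
  arcSet⊆V {v} {y ∷ _} (inj₂ (_ , _ , pred)) =
    proj₂ (R⊆V×V y v (to (pred y) (here refl))) ,
    λ w w∈ys → proj₁ (R⊆V×V w v (to (pred w) w∈ys))

  solution⇒wellDefined : ∀ {σ} → Solves σ E → WellDefined G (configOf σ)
  solution⇒wellDefined {σ} sol = (λ _ _ _ → mk⇔ (λ ()) (λ ())) , sums
    where
    sums : ∀ v a ys → configOf σ v ≡ just a → ArcSet G v ys →
           msum (configOf σ) ys ≡ just a
    sums v a ys refl arcs with arcSet⇒equation arcs
    ... | zs , v=zs , zs↭ys = begin
      msum (configOf σ) ys    ≡⟨ msum-eval (configOf σ) σ ys (λ _ _ → refl) ⟩
      just (sumEval σ ys)     ≡⟨ cong just (sumEval-↭ σ zs↭ys) ⟨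
      just (sumEval σ zs)     ≡⟨ cong just (sol v zs v=zs) ⟨
      just (eval σ v)         ∎
      where open ≡-Reasoning

  wellDefined⇒solution : ∀ {c} → IsConfig G c → Total G c → WellDefined G c →
                         Solves (assignmentOf c) E
  wellDefined⇒solution {c} isC tot (_ , sums) v ys v=ys with arcSet⊆V (T4← v ys v=ys)
  ... | v∈V , ys⊆V = just-injective (begin
    just (eval σ v)         ≡⟨ sums v (eval σ v) ys (c≡σ v v∈V) (T4← v ys v=ys) ⟨
    msum c ys               ≡⟨ msum-eval c σ ys (λ y y∈ys → c≡σ y (ys⊆V y y∈ys)) ⟩
    just (sumEval σ ys)     ∎)
    where
    open ≡-Reasoning
    σ : Assignment
    σ = assignmentOf c
    c≡σ : ∀ v → v ∈ V G → c v ≡ configOf σ v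
    c≡σ = total⇒configOf-assignmentOf {G} isC tot

  confAgrees⇒agreeOn : ∀ {c m} → IsConfig G c → Total G c → ConfAgrees c (places N₁) m →
                       AgreeOn (places N₁) (assignmentOf c) m
  confAgrees⇒agreeOn isC tot agr p p∈P₁ =
    agr p p∈P₁ _ (total⇒configOf-assignmentOf {G} isC tot (name p) (from (T1 p) (inj₁ p∈P₁)))

ReachableViaTFG : Net → Net → Marking → TFG → Marking → Set
ReachableViaTFG N₁ N₂ m₂ G m₁' =
  ∃ λ (c : Config) → IsConfig G c × Total G c × WellDefined G c ×
    ConfAgrees c (places N₁) m₁' ×
    (∃ λ (m₂' : Marking) → Restricts c N₂ m₂' × Reach N₂ m₂ m₂')

theorem2 : (E : System) (N₁ N₂ : Net) (m₁ m₂ : Marking) (G : TFG) →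
    EEquiv E N₁ m₁ N₂ m₂ → WellFormed E N₁ N₂ G →
    ∀ (m₁' : Marking) →
      Reach N₁ m₁ m₁' ⇔
      (∃ λ (c : Config) → IsConfig G c × Total G c × WellDefined G c ×
         ConfAgrees c (places N₁) m₁' ×
         (∃ λ (m₂' : Marking) → Restricts c N₂ m₂' × Reach N₂ m₂ m₂'))
theorem2 E N₁ N₂ m₁ m₂ G equiv wf m₁' = mk⇔ reachable⇒config config⇒reachable
  where
  open EEquiv equiv

  reachable⇒config : Reach N₁ m₁ m₁' → ReachableViaTFG N₁ N₂ m₂ G m₁'
  reachable⇒config m₁'∈R with A1₁ m₁' m₁'∈R
  ... | σ , sol , σ≡m₁' =
    configOf σ , (λ _ _ _ → refl) , (λ v _ → eval σ v , refl) ,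
    solution⇒wellDefined wf sol ,
    (λ { p p∈P₁ _ refl → σ≡m₁' p p∈P₁ }) ,
    σ , (λ _ _ → refl) , to (A3 m₁' σ (σ , sol , σ≡m₁' , λ _ _ → refl)) m₁'∈R

  config⇒reachable : ReachableViaTFG N₁ N₂ m₂ G m₁' → Reach N₁ m₁ m₁'
  config⇒reachable (c , isC , tot , wd , c≡m₁' , m₂' , c≡m₂' , m₂'∈R) =
    from (A3 m₁' m₂' (assignmentOf c , wellDefined⇒solution wf isC tot wd ,
                      confAgrees⇒agreeOn wf isC tot c≡m₁' , restricts⇒agreeOn {c} {N₂} c≡m₂'))
         m₂'∈R
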